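{- Let $G$ be a game having at least one left option and at least one right option, and let $H$ be a game with $H>^+0$. Then for any game $X$ with $o^-(G+X)\in\mathcal N\cup\mathcal P\cup\mathcal L$, Left has a winning move under misère play in $G:H+X$ (Left wins moving first). Further, for any game $Y$ with $o^-(G+Y)\in\mathcal P\cup\mathcal L$, Right has no winning move under misère play in $G:H+Y$ (Right loses moving first).
   Context: Games are short combinatorial games $G=\{G^L\mid G^R\}$. The ordinal sum is defined recursively by $G:H=\{G^L, G:H^L\mid G^R, G:H^R\}$. Outcome classes: $\mathcal N$ (next player wins), $\mathcal P$ (previous player wins), $\mathcal L$ (Left wins whoever starts), $\mathcal R$ (Right wins whoever starts), partially ordered by $\mathcal L>\mathcal N>\mathcal R$, $\mathcal L>\mathcal P>\mathcal R$. $o^+$, $o^-$ are normal-play (last mover wins) and misère-play (last mover loses) outcomes. $G\ge^+H$ means $o^+(G+X)\ge o^+(H+X)$ for all games $X$, and $G>^+H$ means $G\ge^+H$ but not $H\ge^+G$. -}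

module Defs where

open import Data.Nat using (ℕ; zero; suc; _+_)
open import Data.Fin using (Fin; splitAt)
open import Data.Sum using (_⊎_; [_,_]′)
open import Data.Bool using (Bool; true; false; not; _∧_; _∨_)
open import Relation.Binary.PropositionalEquality using (_≡_)
open import Relation.Nullary using (¬_)
open import Data.Product using (_×_)

data Game : Set where
  mk : (nl : ℕ) → (Fin nl → Game) → (nr : ℕ) → (Fin nr → Game) → Game

nL : Game → ℕ
nL (mk nl _ _ _) = nl

nR : Game → ℕ
nR (mk _ _ nr _) = nr

zeroG : Game
zeroG = mk 0 (λ ()) 0 (λ ())

join : {A : Set} {m n : ℕ} → (Fin m → A) → (Fin n → A) → Fin (m + n) → A
join {m = m} f g i = [ f , g ]′ (splitAt m i)

infixl 6 _⊕_
_⊕_ : Game → Game → Game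
mk gl GL gr GR ⊕ mk hl HL hr HR =
  mk (gl + hl)
     (join (λ i → GL i ⊕ mk hl HL hr HR) (λ j → mk gl GL gr GR ⊕ HL j))
     (gr + hr)
     (join (λ i → GR i ⊕ mk hl HL hr HR) (λ j → mk gl GL gr GR ⊕ HR j))

_∶_ : Game → Game → Game
mk gl GL gr GR ∶ mk hl HL hr HR =
  mk (gl + hl) (join GL (λ j → mk gl GL gr GR ∶ HL j))
     (gr + hr) (join GR (λ j → mk gl GL gr GR ∶ HR j))

anyFin : (n : ℕ) → (Fin n → Bool) → Bool
anyFin zero    f = false
anyFin (suc n) f = f Fin.zero ∨ anyFin n (λ i → f (Fin.suc i))

-- Normal play (last mover wins): does Left / Right win moving first?
leftWinsFirst⁺  : Game → Bool
rightWinsFirst⁺ : Game → Bool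
leftWinsFirst⁺  (mk nl GL nr GR) = anyFin nl (λ i → not (rightWinsFirst⁺ (GL i)))
rightWinsFirst⁺ (mk nl GL nr GR) = anyFin nr (λ j → not (leftWinsFirst⁺ (GR j)))

-- Misère play (last mover loses): a player with no move on their turn wins.
isZero : ℕ → Bool
isZero zero = true
isZero (suc _) = false

leftWinsFirst⁻  : Game → Bool
rightWinsFirst⁻ : Game → Bool
leftWinsFirst⁻  (mk nl GL nr GR) =
  isZero nl ∨ anyFin nl (λ i → not (rightWinsFirst⁻ (GL i)))
rightWinsFirst⁻ (mk nl GL nr GR) =
  isZero nr ∨ anyFin nr (λ j → not (leftWinsFirst⁻ (GR j)))

data Outcome : Set where
  𝓛 𝓝 𝓟 𝓡 : Outcome

outcomeOf : Bool → Bool → Outcome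
outcomeOf true  true  = 𝓝
outcomeOf true  false = 𝓛
outcomeOf false true  = 𝓡
outcomeOf false false = 𝓟

o⁺ : Game → Outcome
o⁺ G = outcomeOf (leftWinsFirst⁺ G) (rightWinsFirst⁺ G)

o⁻ : Game → Outcome
o⁻ G = outcomeOf (leftWinsFirst⁻ G) (rightWinsFirst⁻ G)

data _≥ₒ_ : Outcome → Outcome → Set where
  refl≥ : ∀ {o} → o ≥ₒ o
  L≥N : 𝓛 ≥ₒ 𝓝
  L≥P : 𝓛 ≥ₒ 𝓟
  L≥R : 𝓛 ≥ₒ 𝓡
  N≥R : 𝓝 ≥ₒ 𝓡
  P≥R : 𝓟 ≥ₒ 𝓡

_≥⁺_ : Game → Game → Set
G ≥⁺ H = ∀ (X : Game) → o⁺ (G ⊕ X) ≥ₒ o⁺ (H ⊕ X)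

_>⁺_ : Game → Game → Set
G >⁺ H = (G ≥⁺ H) × ¬ (H ≥⁺ G)

module Submission where

-- A game in which Left loses moving first (H ≤ 0) never helps
--    Left in a sum; hence H >⁺ 0 forces o⁺(H) = L: Left wins moving first on H
--    and Right loses moving first on H.
--  * Misère play.  By a simultaneous induction on H and X: Left's misère wins
--    moving first on G + X persist on G:H + X, and Right's losses moving first
--    persist, as soon as Right loses moving first on H in normal play.  Left's
--    extra winning move is G:H^L, available when Left wins H in normal play.
--  * The lemma follows by reading the outcome classes as these two facts.

open import Defs
open import Data.Nat using (_≥_)
open import Data.Bool using (true; false)
open import Data.Sum using (_⊎_)
open import Relation.Binary.PropositionalEquality using (_≡_)
open import Data.Product using (_×_)

open import Data.Nat using (ℕ; zero; suc)
open import Data.Bool using (Bool; not; _∨_)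
open import Data.Bool.Properties using (∨-zeroʳ; ∨-conicalʳ; not-injective; ¬-not)
open import Data.Fin using (Fin; splitAt; _↑ˡ_; _↑ʳ_)
open import Data.Fin.Properties using (splitAt-↑ˡ; splitAt-↑ʳ)
open import Data.Sum using (inj₁; inj₂; [_,_]′)
open import Data.Product using (_,_; ∃; proj₁; proj₂; map₂)
open import Relation.Binary.PropositionalEquality using (refl; sym; trans; cong; cong₂; module ≡-Reasoning)
open import Data.Empty using (⊥)

false≢true : false ≡ true → ⊥
false≢true ()

anyFin-cong : ∀ n {f g : Fin n → Bool} → (∀ i → f i ≡ g i) → anyFin n f ≡ anyFin n g
anyFin-cong zero    eq = refl
anyFin-cong (suc n) eq = cong₂ _∨_ (eq Fin.zero) (anyFin-cong n (λ i → eq (Fin.suc i)))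

anyFin-true : ∀ n {f : Fin n → Bool} (i : Fin n) → f i ≡ true → anyFin n f ≡ true
anyFin-true (suc n) {f} Fin.zero    fi = cong (_∨ anyFin n (λ i → f (Fin.suc i))) fi
anyFin-true (suc n) {f} (Fin.suc i) fi =
  trans (cong (f Fin.zero ∨_) (anyFin-true n i fi)) (∨-zeroʳ (f Fin.zero))

anyFin-witness : ∀ n {f : Fin n → Bool} → anyFin n f ≡ true → ∃ λ i → f i ≡ true
anyFin-witness (suc n) {f} any with f Fin.zero in f0
... | true  = Fin.zero , f0
... | false with anyFin-witness n any
...   | i , fi = Fin.suc i , fi

anyFin-false : ∀ n {f : Fin n → Bool} → (∀ i → f i ≡ false) → anyFin n f ≡ false
anyFin-false zero    none = refl
anyFin-false (suc n) {f} none =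
  trans (cong (_∨ anyFin n (λ i → f (Fin.suc i))) (none Fin.zero))
        (anyFin-false n (λ i → none (Fin.suc i)))

anyFin-false-all : ∀ n {f : Fin n → Bool} → anyFin n f ≡ false → ∀ i → f i ≡ false
anyFin-false-all n {f} none i = ¬-not λ fi → false≢true (trans (sym none) (anyFin-true n i fi))

data Side : Set where
  Left Right : Side

opponent : Side → Side
opponent Left  = Right
opponent Right = Left

moves : Side → Game → ℕ
moves Left  = nL
moves Right = nR

option : (s : Side) (G : Game) → Fin (moves s G) → Game
option Left  (mk _ GL _ _) = GL
option Right (mk _ _ _ GR) = GR

Option : Side → Game → Game → Set
Option s G K = ∃ λ i → option s G i ≡ K

HasMove : Side → Game → Set
HasMove s G = ∃ λ K → Option s G K

hasMove : ∀ s G → moves s G ≥ 1 → HasMove s G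
hasMove Left  (mk (suc _) GL _ _) _ = GL Fin.zero , Fin.zero , refl
hasMove Right (mk _ _ (suc _) GR) _ = GR Fin.zero , Fin.zero , refl

-- Normal and misère play differ only in whether a player who cannot move
-- on their turn wins.

data Convention : Set where
  normal misère : Convention

stuckWins : Convention → ℕ → Bool
stuckWins normal _ = false
stuckWins misère n = isZero n

wins : Convention → Side → Game → Bool
wins normal Left  = leftWinsFirst⁺
wins normal Right = rightWinsFirst⁺
wins misère Left  = leftWinsFirst⁻
wins misère Right = rightWinsFirst⁻

winningOption : Convention → Side → Game → Bool
winningOption c s G = anyFin (moves s G) (λ i → not (wins c (opponent s) (option s G i)))

wins-unfold : ∀ c s G → wins c s G ≡ stuckWins c (moves s G) ∨ winningOption c s G
wins-unfold normal Left  (mk _ _ _ _) = refl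
wins-unfold normal Right (mk _ _ _ _) = refl
wins-unfold misère Left  (mk _ _ _ _) = refl
wins-unfold misère Right (mk _ _ _ _) = refl

hasMove-notStuck : ∀ c s G → HasMove s G → stuckWins c (moves s G) ≡ false
hasMove-notStuck normal s _ _           = refl
hasMove-notStuck misère s _ (_ , i , _) = inhabited-nonzero i
  where
  inhabited-nonzero : ∀ {n} → Fin n → isZero n ≡ false
  inhabited-nonzero Fin.zero    = refl
  inhabited-nonzero (Fin.suc _) = refl

wins-by-move : ∀ c s G {K} → Option s G K → wins c (opponent s) K ≡ false → wins c s G ≡ true
wins-by-move c s G (i , refl) loses =
  trans (wins-unfold c s G)
    (trans (cong (stuckWins c (moves s G) ∨_) (anyFin-true (moves s G) i (cong not loses)))
           (∨-zeroʳ _))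

winning-move : ∀ c s G → stuckWins c (moves s G) ≡ false →
  wins c s G ≡ true → ∃ λ i → wins c (opponent s) (option s G i) ≡ false
winning-move c s G notStuck win = map₂ not-injective (anyFin-witness (moves s G) someWinningOption)
  where
  someWinningOption : winningOption c s G ≡ true
  someWinningOption = begin
    winningOption c s G                            ≡⟨ cong (_∨ winningOption c s G) (sym notStuck) ⟩
    stuckWins c (moves s G) ∨ winningOption c s G  ≡⟨ sym (wins-unfold c s G) ⟩
    wins c s G                                     ≡⟨ win ⟩
    true                                           ∎
    where open ≡-Reasoning

wins-no-move : ∀ c s G → stuckWins c (moves s G) ≡ false →
  (∀ i → wins c (opponent s) (option s G i) ≡ true) → wins c s G ≡ false
wins-no-move c s G notStuck replies = begin
  wins c s G                                     ≡⟨ wins-unfold c s G ⟩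
  stuckWins c (moves s G) ∨ winningOption c s G  ≡⟨ cong (_∨ winningOption c s G) notStuck ⟩
  winningOption c s G                            ≡⟨ anyFin-false (moves s G) (λ i → cong not (replies i)) ⟩
  false                                          ∎
  where open ≡-Reasoning

replies-win : ∀ c s G {K} → wins c s G ≡ false → Option s G K → wins c (opponent s) K ≡ true
replies-win c s G loses (i , refl) =
  not-injective (anyFin-false-all (moves s G) noWinningOption i)
  where
  noWinningOption : winningOption c s G ≡ false
  noWinningOption = ∨-conicalʳ (stuckWins c (moves s G)) _ (trans (sym (wins-unfold c s G)) loses)

join-elim : ∀ {A : Set} {m n} (f : Fin m → A) (g : Fin n → A) (P : A → Set) →
  (∀ i → P (f i)) → (∀ j → P (g j)) → ∀ k → P (join f g k)
join-elim {m = m} f g P onF onG k with splitAt m k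
... | inj₁ i = onF i
... | inj₂ j = onG j

join-↑ˡ : ∀ {A : Set} {m n} (f : Fin m → A) (g : Fin n → A) i → join f g (i ↑ˡ n) ≡ f i
join-↑ˡ {m = m} {n} f g i rewrite splitAt-↑ˡ m i n = refl

join-↑ʳ : ∀ {A : Set} {m n} (f : Fin m → A) (g : Fin n → A) j → join f g (m ↑ʳ j) ≡ g j
join-↑ʳ {m = m} {n} f g j rewrite splitAt-↑ʳ m n j = refl

⊕-optionˡ : ∀ s G X {K} → Option s G K → Option s (G ⊕ X) (K ⊕ X)
⊕-optionˡ Left  G@(mk _ GL _ _) X@(mk xl XL _ _) (i , refl) =
  i ↑ˡ xl , join-↑ˡ (λ i → GL i ⊕ X) (λ j → G ⊕ XL j) i
⊕-optionˡ Right G@(mk _ _ _ GR) X@(mk _ _ xr XR) (i , refl) =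
  i ↑ˡ xr , join-↑ˡ (λ i → GR i ⊕ X) (λ j → G ⊕ XR j) i

⊕-optionʳ : ∀ s G X {K} → Option s X K → Option s (G ⊕ X) (G ⊕ K)
⊕-optionʳ Left  G@(mk gl GL _ _) X@(mk _ XL _ _) (j , refl) =
  gl ↑ʳ j , join-↑ʳ (λ i → GL i ⊕ X) (λ j → G ⊕ XL j) j
⊕-optionʳ Right G@(mk _ _ gr GR) X@(mk _ _ _ XR) (j , refl) =
  gr ↑ʳ j , join-↑ʳ (λ i → GR i ⊕ X) (λ j → G ⊕ XR j) j

⊕-options : ∀ s G X (P : Game → Set) →
  (∀ i → P (option s G i ⊕ X)) → (∀ j → P (G ⊕ option s X j)) → ∀ k → P (option s (G ⊕ X) k)
⊕-options Left  G@(mk _ GL _ _) X@(mk _ XL _ _) P = join-elim (λ i → GL i ⊕ X) (λ j → G ⊕ XL j) P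
⊕-options Right G@(mk _ _ _ GR) X@(mk _ _ _ XR) P = join-elim (λ i → GR i ⊕ X) (λ j → G ⊕ XR j) P

∶-optionˡ : ∀ s G H {K} → Option s G K → Option s (G ∶ H) K
∶-optionˡ Left  G@(mk _ GL _ _) (mk hl HL _ _) (i , refl) = i ↑ˡ hl , join-↑ˡ GL (λ j → G ∶ HL j) i
∶-optionˡ Right G@(mk _ _ _ GR) (mk _ _ hr HR) (i , refl) = i ↑ˡ hr , join-↑ˡ GR (λ j → G ∶ HR j) i

∶-optionʳ : ∀ s G H {K} → Option s H K → Option s (G ∶ H) (G ∶ K)
∶-optionʳ Left  G@(mk gl GL _ _) (mk _ HL _ _) (j , refl) = gl ↑ʳ j , join-↑ʳ GL (λ j → G ∶ HL j) j
∶-optionʳ Right G@(mk _ _ gr GR) (mk _ _ _ HR) (j , refl) = gr ↑ʳ j , join-↑ʳ GR (λ j → G ∶ HR j) j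

∶-options : ∀ s G H (P : Game → Set) →
  (∀ i → P (option s G i)) → (∀ j → P (G ∶ option s H j)) → ∀ k → P (option s (G ∶ H) k)
∶-options Left  G@(mk _ GL _ _) (mk _ HL _ _) P = join-elim GL (λ j → G ∶ HL j) P
∶-options Right G@(mk _ _ _ GR) (mk _ _ _ HR) P = join-elim GR (λ j → G ∶ HR j) P

-- Each case answers the opponent's move in one component.

leftLoses-⊕  : ∀ H X → leftWinsFirst⁺ H ≡ false → leftWinsFirst⁺ X ≡ false →
  leftWinsFirst⁺ (H ⊕ X) ≡ false
rightWins-⊕ʳ : ∀ H X → leftWinsFirst⁺ H ≡ false → rightWinsFirst⁺ X ≡ true →
  rightWinsFirst⁺ (H ⊕ X) ≡ true
rightWins-⊕ˡ : ∀ H X → rightWinsFirst⁺ H ≡ true → leftWinsFirst⁺ X ≡ false →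
  rightWinsFirst⁺ (H ⊕ X) ≡ true

leftLoses-⊕ H@(mk _ HL _ _) X@(mk _ XL _ _) hH hX =
  wins-no-move normal Left (H ⊕ X) refl
    (⊕-options Left H X (λ K → rightWinsFirst⁺ K ≡ true)
      (λ i → rightWins-⊕ˡ (HL i) X (replies-win normal Left H hH (i , refl)) hX)
      (λ j → rightWins-⊕ʳ H (XL j) hH (replies-win normal Left X hX (j , refl))))

rightWins-⊕ʳ H X@(mk _ _ _ XR) hH hX =
  wins-by-move normal Right (H ⊕ X) (⊕-optionʳ Right H X (proj₁ move , refl))
    (leftLoses-⊕ H (XR (proj₁ move)) hH (proj₂ move))
  where
  move : ∃ λ j → leftWinsFirst⁺ (XR j) ≡ false
  move = winning-move normal Right X refl hX

rightWins-⊕ˡ H@(mk _ _ _ HR) X hH hX =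
  wins-by-move normal Right (H ⊕ X) (⊕-optionˡ Right H X (proj₁ move , refl))
    (leftLoses-⊕ (HR (proj₁ move)) X (proj₂ move) hX)
  where
  move : ∃ λ i → leftWinsFirst⁺ (HR i) ≡ false
  move = winning-move normal Right H refl hH

zero-⊕ : ∀ s X → wins normal s (zeroG ⊕ X) ≡ wins normal s X
zero-⊕ Left  (mk xl XL _ _) = anyFin-cong xl (λ i → cong not (zero-⊕ Right (XL i)))
zero-⊕ Right (mk _ _ xr XR) = anyFin-cong xr (λ j → cong not (zero-⊕ Left (XR j)))

outcome-≥ : ∀ {a₁ b₁ a₂ b₂} → (a₂ ≡ true → a₁ ≡ true) → (b₁ ≡ true → b₂ ≡ true) →
  outcomeOf a₁ b₁ ≥ₒ outcomeOf a₂ b₂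
outcome-≥ {false} {_}     {true}  {_}     leftWin _ with leftWin refl
... | ()
outcome-≥ {_}     {true}  {_}     {false} _ rightWin with rightWin refl
... | ()
outcome-≥ {true}  {true}  {true}  {true}  _ _ = refl≥
outcome-≥ {true}  {false} {true}  {true}  _ _ = L≥N
outcome-≥ {true}  {false} {true}  {false} _ _ = refl≥
outcome-≥ {true}  {true}  {false} {true}  _ _ = N≥R
outcome-≥ {true}  {false} {false} {true}  _ _ = L≥R
outcome-≥ {true}  {false} {false} {false} _ _ = L≥P
outcome-≥ {false} {true}  {false} {true}  _ _ = refl≥
outcome-≥ {false} {false} {false} {true}  _ _ = P≥R
outcome-≥ {false} {false} {false} {false} _ _ = refl≥

outcome-≥-right : ∀ {a₁ b₁ a₂ b₂} → outcomeOf a₁ b₁ ≥ₒ outcomeOf a₂ b₂ → b₁ ≡ true → b₂ ≡ true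
outcome-≥-right {true}  {true}  {true}  {true}  _ _ = refl
outcome-≥-right {true}  {true}  {false} {true}  _ _ = refl
outcome-≥-right {false} {true}  {true}  {true}  _ _ = refl
outcome-≥-right {false} {true}  {false} {true}  _ _ = refl
outcome-≥-right {true}  {true}  {true}  {false} () _
outcome-≥-right {true}  {true}  {false} {false} () _
outcome-≥-right {false} {true}  {true}  {false} () _
outcome-≥-right {false} {true}  {false} {false} () _

-- H ≥⁺ 0 forces Right to lose moving first on H: otherwise H + 0 would be a
-- first-player win for Right, while 0 + 0 is not.
rightLoses-of-≥⁺0 : ∀ H → H ≥⁺ zeroG → rightWinsFirst⁺ H ≡ false
rightLoses-of-≥⁺0 H H≥0 =
  ¬-not λ rH → false≢true (outcome-≥-right (H≥0 zeroG) (rightWins-⊕ˡ H zeroG rH refl))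

-- If Left loses moving first on H, then 0 ≥⁺ H: adding H to any X can only
-- turn Left's wins into losses and Right's losses into wins.
0≥⁺-of-leftLoses : ∀ H → leftWinsFirst⁺ H ≡ false → zeroG ≥⁺ H
0≥⁺-of-leftLoses H hH X = outcome-≥ leftWins rightWins
  where
  leftWins : leftWinsFirst⁺ (H ⊕ X) ≡ true → leftWinsFirst⁺ (zeroG ⊕ X) ≡ true
  leftWins lHX = trans (zero-⊕ Left X)
    (¬-not λ lX → false≢true (trans (sym (leftLoses-⊕ H X hH lX)) lHX))
  rightWins : rightWinsFirst⁺ (zeroG ⊕ X) ≡ true → rightWinsFirst⁺ (H ⊕ X) ≡ true
  rightWins r0X = rightWins-⊕ʳ H X hH (trans (sym (zero-⊕ Right X)) r0X)

positive-outcome : ∀ H → H >⁺ zeroG → leftWinsFirst⁺ H ≡ true × rightWinsFirst⁺ H ≡ false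
positive-outcome H (H≥0 , 0≱H) = ¬-not (λ lH → 0≱H (0≥⁺-of-leftLoses H lH)) , rightLoses-of-≥⁺0 H H≥0

-- Since G is never exhausted, the options G^s of G:H behave exactly as in
-- G + X; the options G:H^s are harmless for Left as long as Right loses
-- H moving first in normal play, and give Left a winning move when Left
-- wins H moving first.
module MisèreOrdinalSum (G : Game) (leftMove : HasMove Left G) (rightMove : HasMove Right G) where

  keepsLeftWin   : ∀ H X → rightWinsFirst⁺ H ≡ false →
    leftWinsFirst⁻ (G ⊕ X) ≡ true → leftWinsFirst⁻ ((G ∶ H) ⊕ X) ≡ true
  keepsRightLoss : ∀ H Y → rightWinsFirst⁺ H ≡ false →
    rightWinsFirst⁻ (G ⊕ Y) ≡ false → rightWinsFirst⁻ ((G ∶ H) ⊕ Y) ≡ false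
  leftWins-via-H : ∀ H Y → leftWinsFirst⁺ H ≡ true →
    rightWinsFirst⁻ (G ⊕ Y) ≡ false → leftWinsFirst⁻ ((G ∶ H) ⊕ Y) ≡ true

  -- Left's winning move in G + X is copied in G:H + X; a move X → X^L is
  -- answered by the induction hypothesis for Right's loss.
  keepsLeftWin H X@(mk _ XL _ _) hH win =
    ⊕-options Left G X (λ K → rightWinsFirst⁻ K ≡ false → leftWinsFirst⁻ ((G ∶ H) ⊕ X) ≡ true)
      (λ i → wins-by-move misère Left ((G ∶ H) ⊕ X)
               (⊕-optionˡ Left (G ∶ H) X (∶-optionˡ Left G H (i , refl))))
      (λ j loses → wins-by-move misère Left ((G ∶ H) ⊕ X) (⊕-optionʳ Left (G ∶ H) X (j , refl))
                     (keepsRightLoss H (XL j) hH loses))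
      (proj₁ move) (proj₂ move)
    where
    move : ∃ λ k → rightWinsFirst⁻ (option Left (G ⊕ X) k) ≡ false
    move = winning-move misère Left (G ⊕ X)
             (hasMove-notStuck misère Left (G ⊕ X) (_ , ⊕-optionˡ Left G X (proj₂ leftMove))) win

  -- Right's moves to G^R + Y and G:H + Y^R were already losing in G + Y;
  -- a move to G:H^R + Y leaves Left winning H^R moving first.
  keepsRightLoss H@(mk _ _ _ HR) Y@(mk _ _ _ YR) hH loses =
    wins-no-move misère Right ((G ∶ H) ⊕ Y)
      (hasMove-notStuck misère Right ((G ∶ H) ⊕ Y)
        (_ , ⊕-optionˡ Right (G ∶ H) Y (∶-optionˡ Right G H (proj₂ rightMove))))
      (⊕-options Right (G ∶ H) Y (λ K → leftWinsFirst⁻ K ≡ true)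
        (∶-options Right G H (λ K → leftWinsFirst⁻ (K ⊕ Y) ≡ true)
          (λ i → replies-win misère Right (G ⊕ Y) loses (⊕-optionˡ Right G Y (i , refl)))
          (λ j → leftWins-via-H (HR j) Y (replies-win normal Right H hH (j , refl)) loses))
        (λ j → keepsLeftWin H (YR j) hH
                 (replies-win misère Right (G ⊕ Y) loses (⊕-optionʳ Right G Y (j , refl)))))

  -- Left moves to G:H^L + Y for a winning normal-play move H^L.
  leftWins-via-H H@(mk _ HL _ _) Y hH loses =
    wins-by-move misère Left ((G ∶ H) ⊕ Y)
      (⊕-optionˡ Left (G ∶ H) Y (∶-optionʳ Left G H (proj₁ move , refl)))
      (keepsRightLoss (HL (proj₁ move)) Y (proj₂ move) loses)
    where
    move : ∃ λ i → rightWinsFirst⁺ (HL i) ≡ false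
    move = winning-move normal Left H refl hH

left-or-right-loses : ∀ a b → (outcomeOf a b ≡ 𝓝 ⊎ outcomeOf a b ≡ 𝓟 ⊎ outcomeOf a b ≡ 𝓛) →
  a ≡ true ⊎ b ≡ false
left-or-right-loses true  _     _ = inj₁ refl
left-or-right-loses false false _ = inj₂ refl
left-or-right-loses false true  (inj₁ ())
left-or-right-loses false true  (inj₂ (inj₁ ()))
left-or-right-loses false true  (inj₂ (inj₂ ()))

right-loses : ∀ a b → (outcomeOf a b ≡ 𝓟 ⊎ outcomeOf a b ≡ 𝓛) → b ≡ false
right-loses _     false _ = refl
right-loses true  true  (inj₁ ())
right-loses true  true  (inj₂ ())
right-loses false true  (inj₁ ())
right-loses false true  (inj₂ ())

lemma4p5 : (G H : Game) → nL G ≥ 1 → nR G ≥ 1 → H >⁺ zeroG →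
    (∀ (X : Game) → (o⁻ (G ⊕ X) ≡ 𝓝 ⊎ o⁻ (G ⊕ X) ≡ 𝓟 ⊎ o⁻ (G ⊕ X) ≡ 𝓛) →
    leftWinsFirst⁻ ((G ∶ H) ⊕ X) ≡ true)
    × (∀ (Y : Game) → (o⁻ (G ⊕ Y) ≡ 𝓟 ⊎ o⁻ (G ⊕ Y) ≡ 𝓛) →
    rightWinsFirst⁻ ((G ∶ H) ⊕ Y) ≡ false)
lemma4p5 G H hasLeft hasRight H>0 =
  (λ X o → [ keepsLeftWin H X rH , leftWins-via-H H X lH ]′
             (left-or-right-loses (leftWinsFirst⁻ (G ⊕ X)) (rightWinsFirst⁻ (G ⊕ X)) o))
  , (λ Y o → keepsRightLoss H Y rH (right-loses (leftWinsFirst⁻ (G ⊕ Y)) (rightWinsFirst⁻ (G ⊕ Y)) o))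
  where
  open MisèreOrdinalSum G (hasMove Left G hasLeft) (hasMove Right G hasRight)
  lH : leftWinsFirst⁺ H ≡ true
  lH = proj₁ (positive-outcome H H>0)
  rH : rightWinsFirst⁺ H ≡ false
  rH = proj₂ (positive-outcome H H>0)
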